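{- For integers $0\le k\le n$, the $\gamma$-polynomial of the $q$-binomial coefficient $\left[{n\atop k}\right]_q=\frac{[n]!}{[k]!\,[n-k]!}$ is the lucanomial coefficient $\left\{{n\atop k}\right\}$ evaluated at $s=1$, $t=-z$.
   Context: $[m]=1+q+\cdots+q^{m-1}$, $[m]!=[m]\cdots[1]$, $[0]!=1$. $\left[{n\atop k}\right]_q$ is palindromic of palindromic degree $d=k(n-k)$ (i.e. $q^dh(1/q)=h(q)$), and its $\gamma$-polynomial is $\sum_i\gamma_iz^i$ where $\left[{n\atop k}\right]_q=\sum_{0\le 2i\le d}\gamma_iq^i(1+q)^{d-2i}$. Fibonacci polynomials: $F_0(s,t)=1$, $F_1(s,t)=s$, $F_m=sF_{m-1}+tF_{m-2}$. Define $\{m\}!=\prod_{i=0}^{m-1}F_i(s,t)$ for $m\ge1$ and $\{0\}!=1$, and the lucanomial coefficient $\left\{{n\atop k}\right\}=\frac{\{n\}!}{\{k\}!\,\{n-k\}!}$, which is a polynomial in $s,t$. -}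

module Defs where

open import Data.Nat using (ℕ; zero; suc)
open import Data.Integer using (ℤ; +_; _+_; _*_; _^_)
open import Data.List using (List; []; _∷_)

-- Univariate integer polynomial as coefficient list (constant term first),
-- evaluated by Horner's rule.
evalP : List ℤ → ℤ → ℤ
evalP []       x = + 0
evalP (a ∷ as) x = a + x * evalP as x

-- Bivariate integer polynomial in s,t: the j-th entry is the coefficient
-- (a polynomial in s) of t^j.
evalP2 : List (List ℤ) → ℤ → ℤ → ℤ
evalP2 []       s t = + 0
evalP2 (p ∷ ps) s t = evalP p s + t * evalP2 ps s t

sumTo : ℕ → (ℕ → ℤ) → ℤ
sumTo zero    f = + 0
sumTo (suc m) f = sumTo m f + f m

qint : ℕ → ℤ → ℤ
qint m q = sumTo m (λ i → q ^ i)

qfact : ℕ → ℤ → ℤ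
qfact zero    q = + 1
qfact (suc m) q = qint (suc m) q * qfact m q

fib : ℕ → ℤ → ℤ → ℤ
fib zero          s t = + 1
fib (suc zero)    s t = s
fib (suc (suc m)) s t = s * fib (suc m) s t + t * fib m s t

lfact : ℕ → ℤ → ℤ → ℤ
lfact zero    s t = + 1
lfact (suc m) s t = fib m s t * lfact m s t

module Submission where

-- Write u = -t.  We construct, by a Pascal-type recursion, an explicit
-- coefficient list  γ = lucγ k b  such that for ALL s, t
--     {k+b choose k}(s,t) = Σᵢ γᵢ uⁱ s^(kb-2i)            (the "γ-form").
-- Two specialisations then give the theorem:
--   * s = 1 + q, t = -q turns Fibonacci polynomials into q-integers
--     (F_j = [j+1]_q), hence lucanomials into q-binomials, and the γ-form into
--     Σ γᵢ qⁱ (1+q)^(kb-2i);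
--   * s = 1, t = -z turns the γ-form into Σ γᵢ zⁱ.
-- The given lists B and L are only known through  B·[k]![b]! = [k+b]!  and
-- L·{k}!{b}! = {k+b}!.  Cancelling the factorials is legitimate at natural
-- arguments, where they are positive; an identity between polynomial
-- functions that holds on ℕ holds on ℤ because x - y divides f x - f y.

open import Defs
open import Data.Nat using (ℕ; _≤_; _∸_) renaming (_+_ to _+ℕ_; _*_ to _*ℕ_)
open import Data.Nat.DivMod using (_/_)
open import Data.Integer using (ℤ; +_; -_; _+_; _*_; _^_)
open import Data.List using (List)
open import Data.Product using (Σ; _×_)
open import Relation.Binary.PropositionalEquality using (_≡_)

open import Data.Nat using (zero; suc; _<_; z≤n; s≤s)
import Data.Nat.Properties as ℕP
import Data.Nat.Divisibility as ℕD
open import Data.Nat.DivMod using (m/n≡1+[m∸n]/n)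
open import Data.Integer using (_-_; ∣_∣)
import Data.Integer.Properties as ℤP
open import Data.Integer.Divisibility.Signed using (_∣_; divides; ∣-refl; ∣-trans; ∣⇒∣ᵤ;
  ∣m∣n⇒∣m+n; ∣m⇒∣-m; ∣m⇒∣m*n; ∣n⇒∣m*n)
open import Data.List using ([]; _∷_; length; map)
open import Data.Product using (_,_)
open import Relation.Nullary using (contradiction)
open import Relation.Binary.PropositionalEquality
  using (refl; sym; trans; cong; cong₂; subst; module ≡-Reasoning)
open import Data.Integer.Tactic.RingSolver using (solve-∀)

-- (1) Polynomial identities extend from ℕ to ℤ

-- f has integral difference quotients: x - y divides f x - f y.  Every
-- polynomial function with integer coefficients has this property.
record IntegralDifferences (f : ℤ → ℤ) : Set where
  constructor differences
  field difference-divides : ∀ x y → (x - y) ∣ (f x - f y)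

diff-const : ∀ c → IntegralDifferences (λ _ → c)
diff-const c = differences λ x y →
  divides (+ 0) (trans (ℤP.+-inverseʳ c) (sym (ℤP.*-zeroˡ (x - y))))

diff-id : IntegralDifferences (λ x → x)
diff-id = differences λ x y → ∣-refl

diff-∘ : ∀ {f g} → IntegralDifferences f → IntegralDifferences g →
         IntegralDifferences (λ x → f (g x))
diff-∘ {f} {g} (differences df) (differences dg) = differences λ x y →
  ∣-trans (dg x y) (df (g x) (g y))

diff-neg : ∀ {f} → IntegralDifferences f → IntegralDifferences (λ x → - f x)
diff-neg {f} (differences df) = differences λ x y →
  subst ((x - y) ∣_) (sym (rearrange (f x) (f y))) (∣m⇒∣-m (df x y))
  where
  rearrange : ∀ a b → - a - - b ≡ - (a - b)
  rearrange = solve-∀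

diff-+ : ∀ {f g} → IntegralDifferences f → IntegralDifferences g →
         IntegralDifferences (λ x → f x + g x)
diff-+ {f} {g} (differences df) (differences dg) = differences λ x y →
  subst ((x - y) ∣_) (sym (rearrange (f x) (f y) (g x) (g y))) (∣m∣n⇒∣m+n (df x y) (dg x y))
  where
  rearrange : ∀ a b c d → (a + c) - (b + d) ≡ (a - b) + (c - d)
  rearrange = solve-∀

diff-* : ∀ {f g} → IntegralDifferences f → IntegralDifferences g →
         IntegralDifferences (λ x → f x * g x)
diff-* {f} {g} (differences df) (differences dg) = differences λ x y →
  subst ((x - y) ∣_) (sym (rearrange (f x) (f y) (g x) (g y)))
        (∣m∣n⇒∣m+n (∣m⇒∣m*n (g x) (df x y)) (∣n⇒∣m*n (f y) (dg x y)))
  where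
  rearrange : ∀ a b c d → a * c - b * d ≡ (a - b) * c + b * (c - d)
  rearrange = solve-∀

diff-^ : ∀ {f} → IntegralDifferences f → ∀ n → IntegralDifferences (λ x → f x ^ n)
diff-^ df zero    = diff-const (+ 1)
diff-^ df (suc n) = diff-* df (diff-^ df n)

small-multiple≡0 : ∀ {a b} → b ℕD.∣ a → a < b → a ≡ 0
small-multiple≡0 {zero}  _   _   = refl
small-multiple≡0 {suc a} b∣a a<b = contradiction b∣a (ℕD.>⇒∤ a<b)

-- If f vanishes on ℕ then f z = f z - f m is a multiple of z - m, and for
-- m = |z| + |f z| + 1 we have |z - m| > |f z|, forcing f z = 0.
vanishing-on-ℕ : ∀ {f} → IntegralDifferences f → (∀ m → f (+ m) ≡ + 0) → ∀ z → f z ≡ + 0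
vanishing-on-ℕ {f} (differences df) zero-on-ℕ z = ℤP.∣i∣≡0⇒i≡0 (small-multiple≡0 D∣fz fz<D)
  where
  m = ∣ z ∣ +ℕ suc ∣ f z ∣
  D = z - + m
  D∣fz : ∣ D ∣ ℕD.∣ ∣ f z ∣
  D∣fz = ∣⇒∣ᵤ (subst (D ∣_) (trans (cong (λ y → f z - y) (zero-on-ℕ m)) (ℤP.+-identityʳ (f z)))
                              (df z (+ m)))
  m≤z+D : m ≤ ∣ z ∣ +ℕ ∣ D ∣
  m≤z+D = subst (λ x → ∣ x ∣ ≤ ∣ z ∣ +ℕ ∣ D ∣) (cancel z (+ m)) (ℤP.∣i-j∣≤∣i∣+∣j∣ z D)
    where
    cancel : ∀ a b → a - (a - b) ≡ b
    cancel = solve-∀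
  fz<D : ∣ f z ∣ < ∣ D ∣
  fz<D = ℕP.+-cancelˡ-≤ ∣ z ∣ _ _ m≤z+D

identity-from-ℕ : ∀ {f g} → IntegralDifferences f → IntegralDifferences g →
                  (∀ m → f (+ m) ≡ g (+ m)) → ∀ z → f z ≡ g z
identity-from-ℕ {f} {g} df dg agree z =
  ℤP.i-j≡0⇒i≡j (f z) (g z)
    (vanishing-on-ℕ (diff-+ df (diff-neg dg)) (λ m → ℤP.i≡j⇒i-j≡0 (agree m)) z)

diff-evalP : ∀ p → IntegralDifferences (evalP p)
diff-evalP []      = diff-const (+ 0)
diff-evalP (a ∷ p) = diff-+ (diff-const a) (diff-* diff-id (diff-evalP p))

diff-evalP2 : ∀ L {S T} → IntegralDifferences S → IntegralDifferences T →
              IntegralDifferences (λ x → evalP2 L (S x) (T x))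
diff-evalP2 []      dS dT = diff-const (+ 0)
diff-evalP2 (p ∷ L) dS dT =
  diff-+ (diff-∘ (diff-evalP p) dS) (diff-* dT (diff-evalP2 L dS dT))

Pos : ℤ → Set
Pos x = Σ ℕ (λ k → x ≡ + suc k)

pos-* : ∀ {x y} → Pos x → Pos y → Pos (x * y)
pos-* (a , refl) (b , refl) = _ , sym (ℤP.pos-* (suc a) (suc b))

cancel-pos : ∀ {x y P} → Pos P → x * P ≡ y * P → x ≡ y
cancel-pos {x} {y} (k , refl) = ℤP.*-cancelʳ-≡ x y (+ suc k)

-- (2) Fibonacci polynomials

-- F_(b-1), with the natural convention F_(-1) = 0.
fibPred : ℕ → ℤ → ℤ → ℤ
fibPred zero    s t = + 0
fibPred (suc b) s t = fib b s t

fib-step : ∀ b s t → fib (suc b) s t ≡ s * fib b s t + t * fibPred b s t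
fib-step zero    s t = base s t
  where
  base : ∀ s t → s ≡ s * + 1 + t * + 0
  base = solve-∀
fib-step (suc b) s t = refl

fib-add : ∀ a b s t →
          fib (suc (b +ℕ a)) s t ≡ fib (suc a) s t * fib b s t + t * fibPred b s t * fib a s t
fib-add a zero s t = base (fib (suc a) s t) t (fib a s t)
  where
  base : ∀ x t y → x ≡ x * + 1 + t * + 0 * y
  base = solve-∀
fib-add a (suc zero) s t = base s t (fib (suc a) s t) (fib a s t)
  where
  base : ∀ s t x y → s * x + t * y ≡ x * s + t * + 1 * y
  base = solve-∀
fib-add a (suc (suc b)) s t = begin
  s * fib (suc (suc (b +ℕ a))) s t + t * fib (suc (b +ℕ a)) s t
    ≡⟨ cong₂ (λ x y → s * x + t * y) (fib-add a (suc b) s t) (fib-add a b s t) ⟩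
  s * (A₁ * B₁ + t * B₀ * A₀) + t * (A₁ * B₀ + t * P * A₀)
    ≡⟨ regroup s t A₁ A₀ B₁ B₀ P ⟩
  A₁ * (s * B₁ + t * B₀) + t * (s * B₀ + t * P) * A₀
    ≡⟨ cong (λ x → A₁ * (s * B₁ + t * B₀) + t * x * A₀) (sym (fib-step b s t)) ⟩
  A₁ * (s * B₁ + t * B₀) + t * B₁ * A₀ ∎
  where
  open ≡-Reasoning
  A₁ = fib (suc a) s t
  A₀ = fib a s t
  B₁ = fib (suc b) s t
  B₀ = fib b s t
  P  = fibPred b s t
  regroup : ∀ s t A₁ A₀ B₁ B₀ P →
            s * (A₁ * B₁ + t * B₀ * A₀) + t * (A₁ * B₀ + t * P * A₀)
            ≡ A₁ * (s * B₁ + t * B₀) + t * (s * B₀ + t * P) * A₀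
  regroup = solve-∀

-- (3) γ-forms

-- The γ-form of degree d with coefficients p = (p₀, p₁, …) is the
-- homogeneous polynomial  Σᵢ pᵢ uⁱ s^(d-2i).
γform : ℕ → List ℤ → ℤ → ℤ → ℤ
γform d []      s u = + 0
γform d (a ∷ p) s u = a * s ^ d + u * γform (d ∸ 2) p s u

diff-γform : ∀ d p {S U} → IntegralDifferences S → IntegralDifferences U →
             IntegralDifferences (λ x → γform d p (S x) (U x))
diff-γform d []      dS dU = diff-const (+ 0)
diff-γform d (a ∷ p) dS dU =
  diff-+ (diff-* (diff-const a) (diff-^ dS d)) (diff-* dU (diff-γform (d ∸ 2) p dS dU))

-- p fits degree d when no exponent d - 2i is truncated: 2(length p - 1) ≤ d.
data Fits : ℕ → List ℤ → Set where
  fits-[]  : ∀ {d} → Fits d []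
  fits-[_] : ∀ {d} a → Fits d (a ∷ [])
  fits-∷   : ∀ {d a p} → Fits d p → Fits (suc (suc d)) (a ∷ p)

_⊕_ : List ℤ → List ℤ → List ℤ
[]      ⊕ r       = r
(a ∷ p) ⊕ []      = a ∷ p
(a ∷ p) ⊕ (b ∷ r) = (a + b) ∷ (p ⊕ r)

negate : List ℤ → List ℤ
negate = map (λ x → - x)

-- Multiplication by t = -u, raising the degree by 2.
mulT : List ℤ → List ℤ
mulT X = + 0 ∷ negate X

fits-suc : ∀ {d p} → Fits d p → Fits (suc d) p
fits-suc fits-[]    = fits-[]
fits-suc fits-[ a ] = fits-[ a ]
fits-suc (fits-∷ f) = fits-∷ (fits-suc f)

fits-negate : ∀ {d p} → Fits d p → Fits d (negate p)
fits-negate fits-[]    = fits-[]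
fits-negate fits-[ a ] = fits-[ - a ]
fits-negate (fits-∷ f) = fits-∷ (fits-negate f)

fits-⊕ : ∀ {d p r} → Fits d p → Fits d r → Fits d (p ⊕ r)
fits-⊕ fits-[]              g          = g
fits-⊕ fits-[ a ]           fits-[]    = fits-[ a ]
fits-⊕ fits-[ a ]           fits-[ b ] = fits-[ a + b ]
fits-⊕ fits-[ a ]           (fits-∷ g) = fits-∷ g
fits-⊕ (fits-∷ f)           fits-[]    = fits-∷ f
fits-⊕ (fits-∷ {p = []} f)  fits-[ b ] = fits-∷ f
fits-⊕ (fits-∷ {p = _ ∷ _} f) fits-[ b ] = fits-∷ f
fits-⊕ (fits-∷ f)           (fits-∷ g) = fits-∷ (fits-⊕ f g)

γform-suc : ∀ {d p} → Fits d p → ∀ s u → γform (suc d) p s u ≡ s * γform d p s u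
γform-suc fits-[] s u = sym (ℤP.*-zeroʳ s)
γform-suc {d} fits-[ a ] s u = shift a s (s ^ d) u
  where
  shift : ∀ a s x u → a * (s * x) + u * + 0 ≡ s * (a * x + u * + 0)
  shift = solve-∀
γform-suc {suc (suc d)} (fits-∷ {a = a} {p = p} f) s u =
  trans (cong (λ y → a * (s * s ^ suc (suc d)) + u * y) (γform-suc f s u))
        (shift a s (s ^ suc (suc d)) u (γform d p s u))
  where
  shift : ∀ a s x u y → a * (s * x) + u * (s * y) ≡ s * (a * x + u * y)
  shift = solve-∀

γform-⊕ : ∀ d p r s u → γform d (p ⊕ r) s u ≡ γform d p s u + γform d r s u
γform-⊕ d []      r       s u = sym (ℤP.+-identityˡ _)
γform-⊕ d (a ∷ p) []      s u = sym (ℤP.+-identityʳ _)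
γform-⊕ d (a ∷ p) (b ∷ r) s u =
  trans (cong (λ y → (a + b) * s ^ d + u * y) (γform-⊕ (d ∸ 2) p r s u))
        (regroup a b (s ^ d) u (γform (d ∸ 2) p s u) (γform (d ∸ 2) r s u))
  where
  regroup : ∀ a b x u y z → (a + b) * x + u * (y + z) ≡ (a * x + u * y) + (b * x + u * z)
  regroup = solve-∀

γform-negate : ∀ d p s u → γform d (negate p) s u ≡ - γform d p s u
γform-negate d []      s u = refl
γform-negate d (a ∷ p) s u =
  trans (cong (λ y → - a * s ^ d + u * y) (γform-negate (d ∸ 2) p s u))
        (regroup a (s ^ d) u (γform (d ∸ 2) p s u))
  where
  regroup : ∀ a x u y → - a * x + u * - y ≡ - (a * x + u * y)
  regroup = solve-∀

γform-mulT : ∀ d X s t → γform (suc (suc d)) (mulT X) s (- t) ≡ t * γform d X s (- t)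
γform-mulT d X s t =
  trans (cong (λ y → + 0 * s ^ suc (suc d) + - t * y) (γform-negate d X s (- t)))
        (regroup (s ^ suc (suc d)) t (γform d X s (- t)))
  where
  regroup : ∀ x t y → + 0 * x + - t * - y ≡ t * y
  regroup = solve-∀

-- Multiplication by F_m, following F_(m+2) = s F_(m+1) + t F_m: the factor s
-- is absorbed by raising the degree (γform-suc), the factor t by mulT.
mulFib : ℕ → List ℤ → List ℤ
mulFib zero          X = X
mulFib (suc zero)    X = X
mulFib (suc (suc m)) X = mulFib (suc m) X ⊕ mulT (mulFib m X)

mulFib-fits : ∀ m {e X} → Fits e X → Fits (m +ℕ e) (mulFib m X)
mulFib-fits zero          f = f
mulFib-fits (suc zero)    f = fits-suc f
mulFib-fits (suc (suc m)) f =
  fits-⊕ (fits-suc (mulFib-fits (suc m) f)) (fits-∷ (fits-negate (mulFib-fits m f)))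

mulFib-eval : ∀ m {e X} → Fits e X → ∀ s t →
              γform (m +ℕ e) (mulFib m X) s (- t) ≡ fib m s t * γform e X s (- t)
mulFib-eval zero          f s t = sym (ℤP.*-identityˡ _)
mulFib-eval (suc zero)    f s t = γform-suc f s (- t)
mulFib-eval (suc (suc m)) {e} {X} f s t = begin
  γform (suc (suc (m +ℕ e))) (mulFib (suc m) X ⊕ mulT (mulFib m X)) s (- t)
    ≡⟨ γform-⊕ _ (mulFib (suc m) X) _ s (- t) ⟩
  γform (suc (suc m +ℕ e)) (mulFib (suc m) X) s (- t)
    + γform (suc (suc (m +ℕ e))) (mulT (mulFib m X)) s (- t)
    ≡⟨ cong₂ _+_ (γform-suc (mulFib-fits (suc m) f) s (- t)) (γform-mulT (m +ℕ e) (mulFib m X) s t) ⟩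
  s * γform (suc m +ℕ e) (mulFib (suc m) X) s (- t) + t * γform (m +ℕ e) (mulFib m X) s (- t)
    ≡⟨ cong₂ (λ x y → s * x + t * y) (mulFib-eval (suc m) f s t) (mulFib-eval m f s t) ⟩
  s * (fib (suc m) s t * Y) + t * (fib m s t * Y)
    ≡⟨ regroup s t (fib (suc m) s t) (fib m s t) Y ⟩
  fib (suc (suc m)) s t * Y ∎
  where
  open ≡-Reasoning
  Y = γform e X s (- t)
  regroup : ∀ s t x y z → s * (x * z) + t * (y * z) ≡ (s * x + t * y) * z
  regroup = solve-∀

mulTFibPred : ℕ → List ℤ → List ℤ
mulTFibPred zero    X = []
mulTFibPred (suc b) X = mulT (mulFib b X)

mulTFibPred-fits : ∀ b {e X} → Fits e X → Fits (suc b +ℕ e) (mulTFibPred b X)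
mulTFibPred-fits zero    f = fits-[]
mulTFibPred-fits (suc b) f = fits-∷ (fits-negate (mulFib-fits b f))

mulTFibPred-eval : ∀ b {e X} → Fits e X → ∀ s t →
  γform (suc b +ℕ e) (mulTFibPred b X) s (- t) ≡ t * fibPred b s t * γform e X s (- t)
mulTFibPred-eval zero    {e} {X} f s t = zero-case t (γform e X s (- t))
  where
  zero-case : ∀ t y → + 0 ≡ t * + 0 * y
  zero-case = solve-∀
mulTFibPred-eval (suc b) {e} {X} f s t =
  trans (γform-mulT (b +ℕ e) (mulFib b X) s t)
        (trans (cong (t *_) (mulFib-eval b f s t)) (sym (ℤP.*-assoc t _ _)))

-- (4) The γ-form of the lucanomial coefficient {a+b choose a}

-- Pascal recursion  C(a+1,b+1) = F_(a+1) C(a+1,b) + t F_(b-1) C(a,b+1),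
-- mirroring the addition formula F_(a+b+1) = F_(a+1) F_b + t F_(b-1) F_a.
lucγ : ℕ → ℕ → List ℤ
lucγ zero    b       = + 1 ∷ []
lucγ (suc a) zero    = + 1 ∷ []
lucγ (suc a) (suc b) = mulFib (suc a) (lucγ (suc a) b) ⊕ mulTFibPred b (lucγ a (suc b))

lucγ-fits : ∀ a b → Fits (a *ℕ b) (lucγ a b)
lucγ-fits zero    b       = fits-[ + 1 ]
lucγ-fits (suc a) zero    = fits-[ + 1 ]
lucγ-fits (suc a) (suc b) =
  fits-⊕ (subst (λ d → Fits d (mulFib (suc a) (lucγ (suc a) b)))
                (sym (ℕP.*-suc (suc a) b)) (mulFib-fits (suc a) (lucγ-fits (suc a) b)))
         (mulTFibPred-fits b (lucγ-fits a (suc b)))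

-- The inductive step: the two Pascal summands, multiplied by {a+1}!{b+1}!,
-- combine through the addition formula into F_(a+b+1) {a+b+1}!.
pascal-step : ∀ (g fa fb t f' x y la lb Λ : ℤ) →
  x * ((fa * la) * lb) ≡ Λ → y * (la * (fb * lb)) ≡ Λ →
  (g * x + t * f' * y) * ((fa * la) * (fb * lb)) ≡ (g * fb + t * f' * fa) * Λ
pascal-step g fa fb t f' x y la lb Λ eqX eqY = begin
  (g * x + t * f' * y) * ((fa * la) * (fb * lb))
    ≡⟨ regroup g fa fb t f' x y la lb ⟩
  g * fb * (x * ((fa * la) * lb)) + t * f' * fa * (y * (la * (fb * lb)))
    ≡⟨ cong₂ (λ u v → g * fb * u + t * f' * fa * v) eqX eqY ⟩
  g * fb * Λ + t * f' * fa * Λ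
    ≡⟨ sym (ℤP.*-distribʳ-+ Λ (g * fb) (t * f' * fa)) ⟩
  (g * fb + t * f' * fa) * Λ ∎
  where
  open ≡-Reasoning
  regroup : ∀ g fa fb t f' x y la lb →
    (g * x + t * f' * y) * ((fa * la) * (fb * lb))
    ≡ g * fb * (x * ((fa * la) * lb)) + t * f' * fa * (y * (la * (fb * lb)))
  regroup = solve-∀

lucγ-eval : ∀ a b s t →
  γform (a *ℕ b) (lucγ a b) s (- t) * (lfact a s t * lfact b s t) ≡ lfact (a +ℕ b) s t
lucγ-eval zero b s t = unit t (lfact b s t)
  where
  unit : ∀ t L → (+ 1 * + 1 + - t * + 0) * (+ 1 * L) ≡ L
  unit = solve-∀
lucγ-eval (suc a) zero s t rewrite ℕP.*-zeroʳ a | ℕP.+-identityʳ a = unit t (lfact (suc a) s t)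
  where
  unit : ∀ t L → (+ 1 * + 1 + - t * + 0) * (L * + 1) ≡ L
  unit = solve-∀
lucγ-eval (suc a) (suc b) s t = begin
  γform D (X′ ⊕ Y′) s (- t) * lfacts
    ≡⟨ cong (_* lfacts) (γform-⊕ D X′ Y′ s (- t)) ⟩
  (γform D X′ s (- t) + γform D Y′ s (- t)) * lfacts
    ≡⟨ cong (λ x → (x + γform D Y′ s (- t)) * lfacts)
            (trans (cong (λ d → γform d X′ s (- t)) (ℕP.*-suc (suc a) b))
                   (mulFib-eval (suc a) (lucγ-fits (suc a) b) s t)) ⟩
  (fib (suc a) s t * γform (suc a *ℕ b) X s (- t) + γform D Y′ s (- t)) * lfacts
    ≡⟨ cong (λ y → (fib (suc a) s t * γform (suc a *ℕ b) X s (- t) + y) * lfacts)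
            (mulTFibPred-eval b (lucγ-fits a (suc b)) s t) ⟩
  (fib (suc a) s t * γform (suc a *ℕ b) X s (- t)
    + t * fibPred b s t * γform (a *ℕ suc b) Y s (- t)) * lfacts
    ≡⟨ pascal-step (fib (suc a) s t) (fib a s t) (fib b s t) t (fibPred b s t) _ _
                   (lfact a s t) (lfact b s t) Λ
                   (trans (lucγ-eval (suc a) b s t) (cong (λ m → lfact m s t) a+1+b))
                   (lucγ-eval a (suc b) s t) ⟩
  (fib (suc a) s t * fib b s t + t * fibPred b s t * fib a s t) * Λ
    ≡⟨ cong (_* Λ) (sym (fib-add a b s t)) ⟩
  fib (suc (b +ℕ a)) s t * Λ
    ≡⟨ cong (λ m → fib m s t * Λ) (trans (cong suc (ℕP.+-comm b a)) a+1+b) ⟩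
  lfact (suc a +ℕ suc b) s t ∎
  where
  open ≡-Reasoning
  D = suc a *ℕ suc b
  X = lucγ (suc a) b
  Y = lucγ a (suc b)
  X′ = mulFib (suc a) X
  Y′ = mulTFibPred b Y
  lfacts = lfact (suc a) s t * lfact (suc b) s t
  Λ = lfact (a +ℕ suc b) s t
  a+1+b : suc (a +ℕ b) ≡ a +ℕ suc b
  a+1+b = sym (ℕP.+-suc a b)

-- (5) Coefficients of a γ-form

-- The i-th coefficient of a list, zero beyond its end.
coeff : List ℤ → ℕ → ℤ
coeff []      i       = + 0
coeff (a ∷ p) zero    = a
coeff (a ∷ p) (suc i) = coeff p i

sumTo-cong : ∀ N f g → (∀ i → f i ≡ g i) → sumTo N f ≡ sumTo N g
sumTo-cong zero    f g e = refl
sumTo-cong (suc N) f g e = cong₂ _+_ (sumTo-cong N f g e) (e N)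

sumTo-zero : ∀ N f → (∀ i → f i ≡ + 0) → sumTo N f ≡ + 0
sumTo-zero zero    f e = refl
sumTo-zero (suc N) f e = cong₂ _+_ (sumTo-zero N f e) (e N)

sumTo-shift : ∀ N f → sumTo (suc N) f ≡ f 0 + sumTo N (λ i → f (suc i))
sumTo-shift zero    f = trans (ℤP.+-identityˡ (f 0)) (sym (ℤP.+-identityʳ (f 0)))
sumTo-shift (suc N) f =
  trans (cong (_+ f (suc N)) (sumTo-shift N f)) (ℤP.+-assoc (f 0) _ _)

sumTo-scale : ∀ N u g → sumTo N (λ i → u * g i) ≡ u * sumTo N g
sumTo-scale zero    u g = sym (ℤP.*-zeroʳ u)
sumTo-scale (suc N) u g =
  trans (cong (_+ u * g N) (sumTo-scale N u g)) (sym (ℤP.*-distribˡ-+ u _ _))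

γform-as-sum : ∀ d p s u N → length p ≤ N →
               γform d p s u ≡ sumTo N (λ i → coeff p i * (u ^ i * s ^ (d ∸ 2 *ℕ i)))
γform-as-sum d [] s u N _ = sym (sumTo-zero N _ (λ i → ℤP.*-zeroˡ (u ^ i * s ^ (d ∸ 2 *ℕ i))))
γform-as-sum d (a ∷ p) s u (suc N) (s≤s len) = sym (begin
  sumTo (suc N) (λ i → coeff (a ∷ p) i * (u ^ i * s ^ (d ∸ 2 *ℕ i)))
    ≡⟨ sumTo-shift N _ ⟩
  a * (+ 1 * s ^ d) + sumTo N (λ i → coeff p i * (u * u ^ i * s ^ (d ∸ 2 *ℕ suc i)))
    ≡⟨ cong₂ _+_ (cong (a *_) (ℤP.*-identityˡ (s ^ d)))
                 (sumTo-cong N _ (λ i → u * term i) (λ i → pull-out-u i)) ⟩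
  a * s ^ d + sumTo N (λ i → u * term i)
    ≡⟨ cong (λ y → a * s ^ d + y) (sumTo-scale N u term) ⟩
  a * s ^ d + u * sumTo N term
    ≡⟨ cong (λ y → a * s ^ d + u * y) (sym (γform-as-sum (d ∸ 2) p s u N len)) ⟩
  γform d (a ∷ p) s u ∎)
  where
  open ≡-Reasoning
  term : ℕ → ℤ
  term i = coeff p i * (u ^ i * s ^ (d ∸ 2 ∸ 2 *ℕ i))
  exponent : ∀ i → d ∸ 2 *ℕ suc i ≡ d ∸ 2 ∸ 2 *ℕ i
  exponent i = trans (cong (d ∸_) (ℕP.*-suc 2 i)) (sym (ℕP.∸-+-assoc d 2 (2 *ℕ i)))
  regroup : ∀ c u v x → c * (u * v * x) ≡ u * (c * (v * x))
  regroup = solve-∀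
  pull-out-u : ∀ i → coeff p i * (u * u ^ i * s ^ (d ∸ 2 *ℕ suc i)) ≡ u * term i
  pull-out-u i = trans (cong (λ e → coeff p i * (u * u ^ i * s ^ e)) (exponent i))
                       (regroup (coeff p i) u (u ^ i) _)

γform-at-one : ∀ d p u N → length p ≤ N → γform d p (+ 1) u ≡ sumTo N (λ i → coeff p i * u ^ i)
γform-at-one d p u N len =
  trans (γform-as-sum d p (+ 1) u N len)
        (sumTo-cong N _ _ (λ i → cong (coeff p i *_) (times-one-power (u ^ i) (d ∸ 2 *ℕ i))))
  where
  times-one-power : ∀ x e → x * (+ 1) ^ e ≡ x
  times-one-power x e = trans (cong (x *_) (ℤP.^-zeroˡ e)) (ℤP.*-identityʳ x)

fits-length : ∀ {d p} → Fits d p → length p ≤ d / 2 +ℕ 1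
fits-length fits-[] = z≤n
fits-length {d} fits-[ a ] = subst (1 ≤_) (ℕP.+-comm 1 (d / 2)) (s≤s z≤n)
fits-length {suc (suc d)} (fits-∷ f)
  rewrite m/n≡1+[m∸n]/n {suc (suc d)} {2} (s≤s (s≤s z≤n)) = s≤s (fits-length f)

-- (6) Specialisations and positivity

fib-at-q : ∀ j q → fib j (+ 1 + q) (- q) ≡ qint (suc j) q
fib-at-q zero          q = refl
fib-at-q (suc zero)    q = base q
  where
  base : ∀ q → + 1 + q ≡ (+ 0 + + 1) + q * + 1
  base = solve-∀
fib-at-q (suc (suc j)) q =
  trans (cong₂ (λ x y → (+ 1 + q) * x + - q * y) (fib-at-q (suc j) q) (fib-at-q j q))
        (step q (qint (suc j) q) (q ^ j))
  where
  step : ∀ q Q x → (+ 1 + q) * (Q + q * x) + - q * Q ≡ (Q + q * x) + q * (q * x)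
  step = solve-∀

lfact-at-q : ∀ j q → lfact j (+ 1 + q) (- q) ≡ qfact j q
lfact-at-q zero    q = refl
lfact-at-q (suc j) q = cong₂ _*_ (fib-at-q j q) (lfact-at-q j q)

pow-ℕ : ∀ m n → (+ m) ^ n ≡ + (m Data.Nat.^ n)
pow-ℕ m zero    = refl
pow-ℕ m (suc n) = trans (cong (+ m *_) (pow-ℕ m n)) (sym (ℤP.pos-* m _))

qint-pos : ∀ j m → Pos (qint (suc j) (+ m))
qint-pos zero    m = 0 , refl
qint-pos (suc j) m with qint-pos j m
... | k , e rewrite e | pow-ℕ m (suc j) = _ , refl

qfact-pos : ∀ j m → Pos (qfact j (+ m))
qfact-pos zero    m = 0 , refl
qfact-pos (suc j) m = pos-* (qint-pos j m) (qfact-pos j m)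

fib-pos : ∀ j m → Pos (fib j (+ 1) (+ m))
fib-pos zero          m = 0 , refl
fib-pos (suc zero)    m = 0 , refl
fib-pos (suc (suc j)) m with fib-pos (suc j) m | fib-pos j m
... | a , e₁ | b , e₂
  rewrite e₁ | e₂ | ℤP.*-identityˡ (+ suc a) | sym (ℤP.pos-* m (suc b)) = _ , refl

lfact-pos : ∀ j m → Pos (lfact j (+ 1) (+ m))
lfact-pos zero    m = 0 , refl
lfact-pos (suc j) m = pos-* (fib-pos j m) (lfact-pos j m)

-- (7) The theorem

q-binomial-γform : ∀ k b B →
  (∀ q → evalP B q * (qfact k q * qfact b q) ≡ qfact (k +ℕ b) q) →
  ∀ q → evalP B q ≡ γform (k *ℕ b) (lucγ k b) (+ 1 + q) q
q-binomial-γform k b B hB =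
  identity-from-ℕ (diff-evalP B)
    (diff-γform (k *ℕ b) (lucγ k b) (diff-+ (diff-const (+ 1)) diff-id) diff-id)
    (λ m → cancel-pos (pos-* (qfact-pos k m) (qfact-pos b m)) (on-ℕ (+ m)))
  where
  on-ℕ : ∀ q → evalP B q * (qfact k q * qfact b q)
             ≡ γform (k *ℕ b) (lucγ k b) (+ 1 + q) q * (qfact k q * qfact b q)
  on-ℕ q = begin
    evalP B q * (qfact k q * qfact b q)   ≡⟨ hB q ⟩
    qfact (k +ℕ b) q                      ≡⟨ sym (lfact-at-q (k +ℕ b) q) ⟩
    lfact (k +ℕ b) (+ 1 + q) (- q)        ≡⟨ sym (lucγ-eval k b (+ 1 + q) (- q)) ⟩
    γform (k *ℕ b) (lucγ k b) (+ 1 + q) (- - q)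
      * (lfact k (+ 1 + q) (- q) * lfact b (+ 1 + q) (- q))
      ≡⟨ cong₂ (λ u v → γform (k *ℕ b) (lucγ k b) (+ 1 + q) u * v) (ℤP.neg-involutive q)
               (cong₂ _*_ (lfact-at-q k q) (lfact-at-q b q)) ⟩
    γform (k *ℕ b) (lucγ k b) (+ 1 + q) q * (qfact k q * qfact b q) ∎
    where open ≡-Reasoning

lucanomial-γform : ∀ k b L →
  (∀ s t → evalP2 L s t * (lfact k s t * lfact b s t) ≡ lfact (k +ℕ b) s t) →
  ∀ t → γform (k *ℕ b) (lucγ k b) (+ 1) (- t) ≡ evalP2 L (+ 1) t
lucanomial-γform k b L hL =
  identity-from-ℕ (diff-γform (k *ℕ b) (lucγ k b) (diff-const (+ 1)) (diff-neg diff-id))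
    (diff-evalP2 L (diff-const (+ 1)) diff-id)
    (λ m → cancel-pos (pos-* (lfact-pos k m) (lfact-pos b m))
                      (trans (lucγ-eval k b (+ 1) (+ m)) (sym (hL (+ 1) (+ m)))))

proposition3p6 : (n k : ℕ) → k ≤ n →
    (B : List ℤ) →
    (∀ q → evalP B q * (qfact k q * qfact (n ∸ k) q) ≡ qfact n q) →
    (L : List (List ℤ)) →
    (∀ s t → evalP2 L s t * (lfact k s t * lfact (n ∸ k) s t) ≡ lfact n s t) →
    Σ (ℕ → ℤ) (λ γ →
      (∀ q → evalP B q
             ≡ sumTo (k *ℕ (n ∸ k) / 2 +ℕ 1)
                 (λ i → γ i * (q ^ i * ((+ 1 + q) ^ (k *ℕ (n ∸ k) ∸ 2 *ℕ i))))) ×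
      (∀ z → sumTo (k *ℕ (n ∸ k) / 2 +ℕ 1) (λ i → γ i * z ^ i)
             ≡ evalP2 L (+ 1) (- z)))
proposition3p6 n k k≤n B hB L hL = coeff γ , expansion , γ-polynomial
  where
  b = n ∸ k
  d = k *ℕ b
  N = d / 2 +ℕ 1
  γ = lucγ k b
  k+b≡n : k +ℕ b ≡ n
  k+b≡n = ℕP.m+[n∸m]≡n k≤n
  length≤N : length γ ≤ N
  length≤N = fits-length (lucγ-fits k b)
  expansion : ∀ q → evalP B q ≡ sumTo N (λ i → coeff γ i * (q ^ i * ((+ 1 + q) ^ (d ∸ 2 *ℕ i))))
  expansion q =
    trans (q-binomial-γform k b B (λ q → trans (hB q) (cong (λ m → qfact m q) (sym k+b≡n))) q)
          (γform-as-sum d γ (+ 1 + q) q N length≤N)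
  γ-polynomial : ∀ z → sumTo N (λ i → coeff γ i * z ^ i) ≡ evalP2 L (+ 1) (- z)
  γ-polynomial z = begin
    sumTo N (λ i → coeff γ i * z ^ i)  ≡⟨ sym (γform-at-one d γ z N length≤N) ⟩
    γform d γ (+ 1) z                  ≡⟨ cong (γform d γ (+ 1)) (sym (ℤP.neg-involutive z)) ⟩
    γform d γ (+ 1) (- - z)            ≡⟨ lucanomial-γform k b L hL′ (- z) ⟩
    evalP2 L (+ 1) (- z)               ∎
    where
    open ≡-Reasoning
    hL′ : ∀ s t → evalP2 L s t * (lfact k s t * lfact b s t) ≡ lfact (k +ℕ b) s t
    hL′ s t = trans (hL s t) (cong (λ m → lfact m s t) (sym k+b≡n))
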